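{- Let $x<y$ be coprime nonnegative integers, and let $\frac{x}{y}=[0;a_1,a_2,\ldots,a_n]$ be a continued fraction expansion. For coprime nonnegative integers $u,v$, we have either $\begin{pmatrix} u\\ v\end{pmatrix}\in\Psi_2\begin{pmatrix} x\\ y\end{pmatrix}$ or $\begin{pmatrix} v\\ u\end{pmatrix}\in\Psi_2\begin{pmatrix} x\\ y\end{pmatrix}$ if and only if $\frac{u}{v}$ has a continued fraction of the form \[ \frac{u}{v}= [4b_0;4b_1, 4b_2, \ldots, 4b_{m-1}, 4b_m+ a_1, a_2, \ldots, a_n], \] where the $b_i$ are nonnegative integers with $b_i>0$ if $1\leq i\leq m-1$.
   Context: $\Psi_2=\left\langle\begin{pmatrix} 1 & 4\\ 0 & 1\end{pmatrix},\begin{pmatrix} 1 & 0\\ 4 & 1\end{pmatrix}\right\rangle^+$, the monoid generated by these two matrices (including the identity), acting on column vectors. -}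

module Defs where

open import Data.Nat using (ℕ; zero; suc; _+_; _*_; _≤_; _<_)
open import Data.Product using (_×_; _,_; proj₁; proj₂; Σ; ∃)
open import Data.List using (List; []; _∷_)
open import Data.Vec using (Vec; []; _∷_; lookup)
open import Data.Fin using (Fin; toℕ)
open import Relation.Binary.PropositionalEquality using (_≡_)

record Mat2 : Set where
  constructor mat
  field
    m11 m12 m21 m22 : ℕ
open Mat2 public

_⊗_ : Mat2 → Mat2 → Mat2
mat a b c d ⊗ mat e f g h = mat (a * e + b * g) (a * f + b * h) (c * e + d * g) (c * f + d * h)

I₂ : Mat2
I₂ = mat 1 0 0 1

A₄ : Mat2
A₄ = mat 1 4 0 1

B₄ : Mat2
B₄ = mat 1 0 4 1

data Ψ₂ : Mat2 → Set where
  ψ-one : Ψ₂ I₂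
  ψ-A   : Ψ₂ A₄
  ψ-B   : Ψ₂ B₄
  ψ-mul : ∀ {M N} → Ψ₂ M → Ψ₂ N → Ψ₂ (M ⊗ N)

_·_ : Mat2 → ℕ × ℕ → ℕ × ℕ
mat a b c d · (p , q) = (a * p + b * q , c * p + d * q)

_∈Ψ₂·_ : ℕ × ℕ → ℕ × ℕ → Set
w ∈Ψ₂· w₀ = Σ Mat2 λ M → Ψ₂ M × (M · w₀ ≡ w)

-- Numerator/denominator of the finite continued fraction [c₀; c₁, …, c_k]
-- (computed by the standard recursion; the empty list stands for 1/0).
cfEval : List ℕ → ℕ × ℕ
cfEval [] = (1 , 0)
cfEval (c ∷ cs) with cfEval cs
... | (p , q) = (c * p + q , p)

_/_≐cf_ : ℕ → ℕ → List ℕ → Set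
u / v ≐cf cs = u * proj₂ (cfEval cs) ≡ v * proj₁ (cfEval cs)

-- For b = (b₀, …, b_m), a₁ and (a₂, …, a_n), the list of partial quotients
-- [4b₀; 4b₁, …, 4b_{m-1}, 4b_m + a₁, a₂, …, a_n]
formTerms : ∀ {m} → Vec ℕ (suc m) → ℕ → List ℕ → List ℕ
formTerms (b ∷ []) a₁ as = (4 * b + a₁) ∷ as
formTerms (b ∷ b′ ∷ bs) a₁ as = (4 * b) ∷ formTerms (b′ ∷ bs) a₁ as

MidPositive : ∀ {m} → Vec ℕ (suc m) → Set
MidPositive {m} b = (i : Fin (suc m)) → 1 ≤ toℕ i → toℕ i < m → 0 < lookup b i

{-# OPTIONS --safe #-}
module Submission where

-- Ψ₂ is generated by the shift (p , q) ↦ (p + 4q , q) and its conjugate by the swap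
-- (p , q) ↦ (q , p), so the pairs w with w or swap w in Ψ₂ (x , y) form the least set
-- that contains (y , x) and is closed under swap and shift. On continued fractions the
-- shift adds 4 to the leading partial quotient, while the swap adds or removes a leading
-- quotient 0. Hence the pairs with an expansion [4b₀; …, 4b_m + a₁, a₂, …, a_n] form
-- that same least set, (y , x) being [a₁; a₂, …, a_n]. Coprimality turns the
-- cross-multiplied equalities into equalities of pairs.

open import Defs
open import Data.Nat using (ℕ; suc; zero; _≤_; _<_; _+_; _*_; s≤s; z≤n)
open import Data.Nat.Coprimality as Coprime using (Coprime; coprime-divisor; 1-coprimeTo)
open import Data.Nat.Divisibility using (_∣_; ∣-antisym; ∣-trans; n∣m*n; m∣m*n; ∣m+n∣m⇒∣n)
open import Data.Nat.Properties using (*-comm; *-suc; +-identityʳ)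
open import Data.Nat.Tactic.RingSolver using (solve-∀)
open import Data.Product using (_×_; _,_; Σ; proj₁; proj₂; swap)
open import Data.Sum using (_⊎_; inj₁; inj₂)
open import Data.List using (List; _∷_; [])
open import Data.List.Relation.Unary.All using (All)
open import Data.Vec using (Vec; _∷_; [])
open import Data.Fin using (zero; suc)
open import Function.Bundles using (_⇔_; mk⇔; module Equivalence)
open import Function.Construct.Composition using (_⇔-∘_)
open import Relation.Binary.PropositionalEquality

shift : ℕ × ℕ → ℕ × ℕ
shift (p , q) = (p + 4 * q , q)

·-identity : ∀ w → I₂ · w ≡ w
·-identity (p , q) = cong₂ _,_ (trans (+-identityʳ (p + 0)) (+-identityʳ p)) (+-identityʳ q)

A₄·≡shift : ∀ w → A₄ · w ≡ shift w
A₄·≡shift (p , q) = cong₂ _,_ (cong (_+ 4 * q) (+-identityʳ p)) (+-identityʳ q)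

B₄·≡conjugate-shift : ∀ w → B₄ · w ≡ swap (shift (swap w))
B₄·≡conjugate-shift (p , q) = cong₂ _,_ (trans (+-identityʳ (p + 0)) (+-identityʳ p)) (lemma p q)
  where
  lemma : ∀ p q → 4 * p + 1 * q ≡ q + 4 * p
  lemma = solve-∀

·-⊗ : ∀ M N w → (M ⊗ N) · w ≡ M · (N · w)
·-⊗ (mat a b c d) (mat e f g h) (p , q) = cong₂ _,_ (lemma a b e f g h p q) (lemma c d e f g h p q)
  where
  lemma : ∀ a b e f g h p q →
          (a * e + b * g) * p + (a * f + b * h) * q ≡ a * (e * p + f * q) + b * (g * p + h * q)
  lemma = solve-∀

record SwapShiftClosed (P : ℕ × ℕ → Set) : Set where
  field
    swap-closed  : ∀ {w} → P w → P (swap w)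
    shift-closed : ∀ {w} → P w → P (shift w)

module _ {P : ℕ × ℕ → Set} (closed : SwapShiftClosed P) where
  open SwapShiftClosed closed

  Ψ₂-preserves : ∀ {M w} → Ψ₂ M → P w → P (M · w)
  Ψ₂-preserves {w = w} ψ-one pw = subst P (sym (·-identity w)) pw
  Ψ₂-preserves {w = w} ψ-A   pw = subst P (sym (A₄·≡shift w)) (shift-closed pw)
  Ψ₂-preserves {w = w} ψ-B   pw =
    subst P (sym (B₄·≡conjugate-shift w)) (swap-closed (shift-closed (swap-closed pw)))
  Ψ₂-preserves {w = w} (ψ-mul {M} {N} ψM ψN) pw =
    subst P (sym (·-⊗ M N w)) (Ψ₂-preserves ψM (Ψ₂-preserves ψN pw))

∈Ψ₂·-closed : ∀ {N w w₀} → Ψ₂ N → w ∈Ψ₂· w₀ → (N · w) ∈Ψ₂· w₀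
∈Ψ₂·-closed {N} {w₀ = w₀} ψN (M , ψM , refl) = N ⊗ M , ψ-mul ψN ψM , ·-⊗ N M w₀

SwapOrbit : ℕ × ℕ → ℕ × ℕ → Set
SwapOrbit w₀ w = (w ∈Ψ₂· w₀) ⊎ (swap w ∈Ψ₂· w₀)

swapOrbit-closed : ∀ w₀ → SwapShiftClosed (SwapOrbit w₀)
swapOrbit-closed w₀ = record { swap-closed = swap-closed ; shift-closed = shift-closed }
  where
  swap-closed : ∀ {w} → SwapOrbit w₀ w → SwapOrbit w₀ (swap w)
  swap-closed (inj₁ o) = inj₂ o
  swap-closed (inj₂ o) = inj₁ o

  shift-closed : ∀ {w} → SwapOrbit w₀ w → SwapOrbit w₀ (shift w)
  shift-closed {w} (inj₁ o) = inj₁ (subst (_∈Ψ₂· w₀) (A₄·≡shift w) (∈Ψ₂·-closed ψ-A o))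
  shift-closed {w} (inj₂ o) =
    inj₂ (subst (_∈Ψ₂· w₀) (B₄·≡conjugate-shift (swap w)) (∈Ψ₂·-closed ψ-B o))

swapOrbit-base : ∀ w₀ → SwapOrbit w₀ w₀
swapOrbit-base w₀ = inj₁ (I₂ , ψ-one , ·-identity w₀)

swapOrbit-least : ∀ {P w₀ w} → SwapShiftClosed P → P w₀ → SwapOrbit w₀ w → P w
swapOrbit-least closed p₀ (inj₁ (M , ψM , refl)) = Ψ₂-preserves closed ψM p₀
swapOrbit-least {P} closed p₀ (inj₂ (M , ψM , e)) =
  SwapShiftClosed.swap-closed closed (subst P e (Ψ₂-preserves closed ψM p₀))

cfEval-coprime : ∀ cs → Coprime (proj₁ (cfEval cs)) (proj₂ (cfEval cs))
cfEval-coprime []       = 1-coprimeTo 0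
cfEval-coprime (c ∷ cs) (d∣cp+q , d∣p) =
  cfEval-coprime cs (d∣p , ∣m+n∣m⇒∣n d∣cp+q (∣-trans d∣p (n∣m*n c)))

coprime-cross⇒∣ : ∀ {u v p q} → Coprime u v → u * q ≡ v * p → u ∣ p
coprime-cross⇒∣ {u} {q = q} c e = coprime-divisor c (subst (u ∣_) e (m∣m*n q))

coprime-cross⇒≡ : ∀ {u v p q} → Coprime u v → Coprime p q → u * q ≡ v * p → (u , v) ≡ (p , q)
coprime-cross⇒≡ {u} {v} {p} {q} cuv cpq e = cong₂ _,_
  (∣-antisym (coprime-cross⇒∣ cuv e) (coprime-cross⇒∣ cpq e′))
  (∣-antisym (coprime-cross⇒∣ (Coprime.sym cuv) (sym e)) (coprime-cross⇒∣ (Coprime.sym cpq) (sym e′)))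
  where
  e′ : p * v ≡ q * u
  e′ = trans (*-comm p v) (trans (sym e) (*-comm u q))

≐cf⇔≡cfEval : ∀ {u v} cs → Coprime u v → (u / v ≐cf cs) ⇔ ((u , v) ≡ cfEval cs)
≐cf⇔≡cfEval {u} {v} cs cuv = mk⇔ (λ e → coprime-cross⇒≡ cuv (cfEval-coprime cs) e) from
  where
  from : (u , v) ≡ cfEval cs → u / v ≐cf cs
  from e rewrite sym e = *-comm u v

cfEval-4+ : ∀ c cs → cfEval ((4 + c) ∷ cs) ≡ shift (cfEval (c ∷ cs))
cfEval-4+ c cs = cong (_, proj₁ (cfEval cs)) (lemma c (proj₁ (cfEval cs)) (proj₂ (cfEval cs)))
  where
  lemma : ∀ c p q → (4 + c) * p + q ≡ c * p + q + 4 * p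
  lemma = solve-∀

midPositive-singleton : ∀ b → MidPositive (b ∷ [])
midPositive-singleton b zero ()

midPositive-pair : ∀ b₀ b₁ → MidPositive (b₀ ∷ b₁ ∷ [])
midPositive-pair b₀ b₁ zero ()
midPositive-pair b₀ b₁ (suc zero) _ (s≤s ())

midPositive-tail : ∀ {m b} {bs : Vec ℕ (suc m)} → MidPositive (b ∷ bs) → MidPositive bs
midPositive-tail mid i _ i<m = mid (suc i) (s≤s z≤n) (s≤s i<m)

midPositive-changeHead : ∀ {m b c} {bs : Vec ℕ m} → MidPositive (b ∷ bs) → MidPositive (c ∷ bs)
midPositive-changeHead mid zero ()
midPositive-changeHead mid (suc i) = mid (suc i)

midPositive-cons : ∀ {m b c} {bs : Vec ℕ m} → 0 < b → MidPositive (b ∷ bs) → MidPositive (c ∷ b ∷ bs)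
midPositive-cons b>0 mid zero ()
midPositive-cons b>0 mid (suc zero) _ _ = b>0
midPositive-cons b>0 mid (suc (suc i)) _ (s≤s i<m) = mid (suc i) (s≤s z≤n) i<m

module _ (a₁ : ℕ) (as : List ℕ) where

  Ψ₂Expansion : ℕ × ℕ → Set
  Ψ₂Expansion w = Σ ℕ λ m → Σ (Vec ℕ (suc m)) λ b → MidPositive b × (w ≡ cfEval (formTerms b a₁ as))

  cfEval-formTerms-suc : ∀ {m} b (bs : Vec ℕ m) →
    cfEval (formTerms (suc b ∷ bs) a₁ as) ≡ shift (cfEval (formTerms (b ∷ bs) a₁ as))
  cfEval-formTerms-suc b [] =
    trans (cong (λ c → cfEval (c ∷ as)) (lemma b a₁)) (cfEval-4+ (4 * b + a₁) as)
    where
    lemma : ∀ b c → 4 * suc b + c ≡ 4 + (4 * b + c)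
    lemma = solve-∀
  cfEval-formTerms-suc b (b′ ∷ bs) =
    trans (cong (λ c → cfEval (c ∷ cs)) (*-suc 4 b)) (cfEval-4+ (4 * b) cs)
    where
    cs = formTerms (b′ ∷ bs) a₁ as

  Ψ₂Expansion-base : Ψ₂Expansion (cfEval (a₁ ∷ as))
  Ψ₂Expansion-base = 0 , 0 ∷ [] , midPositive-singleton 0 , refl

  Ψ₂Expansion-closed : SwapShiftClosed Ψ₂Expansion
  Ψ₂Expansion-closed = record { swap-closed = swap-closed ; shift-closed = shift-closed }
    where
    swap-closed : ∀ {w} → Ψ₂Expansion w → Ψ₂Expansion (swap w)
    swap-closed (zero  , 0 ∷ []      , _   , refl) = 1 , 0 ∷ 0 ∷ [] , midPositive-pair 0 0 , refl
    swap-closed (suc m , 0 ∷ b₁ ∷ bs , mid , refl) = m , b₁ ∷ bs , midPositive-tail mid , refl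
    swap-closed (m , suc b ∷ bs , mid , refl) =
      suc m , 0 ∷ suc b ∷ bs , midPositive-cons (s≤s z≤n) mid , refl

    shift-closed : ∀ {w} → Ψ₂Expansion w → Ψ₂Expansion (shift w)
    shift-closed (m , b ∷ bs , mid , refl) =
      m , suc b ∷ bs , midPositive-changeHead mid , sym (cfEval-formTerms-suc b bs)

  Ψ₂Expansion-least : ∀ {P w} → SwapShiftClosed P → P (cfEval (a₁ ∷ as)) → Ψ₂Expansion w → P w
  Ψ₂Expansion-least {P} closed p₀ (_ , b ∷ bs , _ , refl) = go b bs
    where
    open SwapShiftClosed closed
    go : ∀ {m} b (bs : Vec ℕ m) → P (cfEval (formTerms (b ∷ bs) a₁ as))
    go zero    []        = p₀
    go zero    (b₁ ∷ bs) = swap-closed (go b₁ bs)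
    go (suc b) bs        = subst P (sym (cfEval-formTerms-suc b bs)) (shift-closed (go b bs))

  swapOrbit⇔Ψ₂Expansion : ∀ {w₀ w} → w₀ ≡ cfEval (0 ∷ a₁ ∷ as) → SwapOrbit w₀ w ⇔ Ψ₂Expansion w
  swapOrbit⇔Ψ₂Expansion {w₀} refl = mk⇔
    (swapOrbit-least Ψ₂Expansion-closed w₀-expansion)
    (Ψ₂Expansion-least (swapOrbit-closed w₀) swap-w₀-in-orbit)
    where
    w₀-expansion : Ψ₂Expansion w₀
    w₀-expansion = SwapShiftClosed.swap-closed Ψ₂Expansion-closed Ψ₂Expansion-base

    swap-w₀-in-orbit : SwapOrbit w₀ (swap w₀)
    swap-w₀-in-orbit = SwapShiftClosed.swap-closed (swapOrbit-closed w₀) (swapOrbit-base w₀)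

  Ψ₂Expansion⇔≐cf : ∀ {u v} → Coprime u v → Ψ₂Expansion (u , v)
    ⇔ (Σ ℕ λ m → Σ (Vec ℕ (suc m)) λ b → MidPositive b × (u / v ≐cf formTerms b a₁ as))
  Ψ₂Expansion⇔≐cf cuv = mk⇔
    (λ (m , b , mid , e) → m , b , mid , Equivalence.from (≐cf⇔≡cfEval (formTerms b a₁ as) cuv) e)
    (λ (m , b , mid , e) → m , b , mid , Equivalence.to (≐cf⇔≡cfEval (formTerms b a₁ as) cuv) e)

proposition8p1 : (x y : ℕ) → Coprime x y → x < y →
    (a₁ : ℕ) (as : List ℕ) → All (1 ≤_) (a₁ ∷ as) →
    x / y ≐cf (0 ∷ a₁ ∷ as) →
    (u v : ℕ) → Coprime u v →
    (((u , v) ∈Ψ₂· (x , y)) ⊎ ((v , u) ∈Ψ₂· (x , y)))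
      ⇔ (Σ ℕ λ m → Σ (Vec ℕ (suc m)) λ b → MidPositive b × (u / v ≐cf formTerms b a₁ as))
proposition8p1 x y cxy _ a₁ as _ x/y≐cf u v cuv =
  Ψ₂Expansion⇔≐cf a₁ as cuv ⇔-∘ swapOrbit⇔Ψ₂Expansion a₁ as xy≡cfEval
  where
  xy≡cfEval : (x , y) ≡ cfEval (0 ∷ a₁ ∷ as)
  xy≡cfEval = Equivalence.to (≐cf⇔≡cfEval (0 ∷ a₁ ∷ as) cxy) x/y≐cf
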